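{- Let $n\ge 4$. Then $w_1=n$ and $W_1=\{\mathbf{a}_1,\mathbf{a}_2,\mathbf{a}_3\}$, where $\mathbf{a}_1=\overline{1}[n]$ (the all-ones sequence), $\mathbf{a}_2=1\cdot\overline{0}[n-1]$ and $\mathbf{a}_3=\overline{0}[n-1]\cdot 1$.
   Context: For $\mathbf{x}=(x_0,\ldots,x_{n-1})\in\mathbb{F}_2^n$, the derivative is $\partial\mathbf{x}=(x_0+x_1,x_1+x_2,\ldots,x_{n-2}+x_{n-1})\in\mathbb{F}_2^{n-1}$, with $\partial^0\mathbf{x}=\mathbf{x}$ and $\partial^i\mathbf{x}=\partial(\partial^{i-1}\mathbf{x})$. The Steinhaus triangle of $\mathbf{x}$ is $T(\mathbf{x})=(\mathbf{x},\partial\mathbf{x},\ldots,\partial^{n-1}\mathbf{x})$. The weight $|\mathbf{y}|$ of a binary sequence is its number of ones, and $|T(\mathbf{x})|=\sum_{i=0}^{n-1}|\partial^i\mathbf{x}|$. For fixed $n$, let $0=w_0<w_1<\cdots<w_m$ be all the distinct values of $|T(\mathbf{x})|$ for $\mathbf{x}\in\mathbb{F}_2^n$, and let $W_i=\{\mathbf{x}\in\mathbb{F}_2^n:|T(\mathbf{x})|=w_i\}$. Sequences are written as words; a dot denotes concatenation; $\overline{x_1\cdots x_p}[k]$ denotes the word formed by the first $k$ letters of the infinite periodic word $x_1\cdots x_px_1\cdots x_p\cdots$. -}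

module Defs where

open import Data.Bool using (Bool; true; false; _xor_)
open import Data.Nat using (ℕ; zero; suc; _+_)
open import Data.Vec using (Vec; []; _∷_; replicate; _++_)

-- binary sequences of length n: Vec Bool n, true = 1, false = 0

weight : ∀ {n} → Vec Bool n → ℕ
weight []          = 0
weight (true ∷ xs) = suc (weight xs)
weight (false ∷ xs) = weight xs

∂ : ∀ {n} → Vec Bool (suc n) → Vec Bool n
∂ (x ∷ [])     = []
∂ (x ∷ y ∷ xs) = (x xor y) ∷ ∂ (y ∷ xs)

triangleWeight : ∀ {n} → Vec Bool n → ℕ
triangleWeight []           = 0
triangleWeight (x ∷ xs) = weight (x ∷ xs) + triangleWeight (∂ (x ∷ xs))

a₁ : (n : ℕ) → Vec Bool n
a₁ n = replicate n true

a₂ : (n : ℕ) → Vec Bool (suc n)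
a₂ n = true ∷ replicate n false

-- a3 = 0^(n-1) · 1  (n zeros followed by a one, length suc n)
a₃ : (n : ℕ) → Vec Bool (suc n)
a₃ zero    = true ∷ []
a₃ (suc n) = false ∷ a₃ n

-- If ∂x = 0 then x is constant; otherwise |T(x)| = |x| + |T(∂x)| and induction on the length
-- gives |T(x)| ≥ n for every nonzero x, with |T(x)| = n forcing x = 1ⁿ or |x| = 1.
-- A single one at an interior position makes ∂x a non-constant word of weight 2, so then
-- |T(∂x)| ≥ 2 + (n − 2) and |T(x)| > n; what remains is a one at either end, i.e. a₂ or a₃.
-- Non-constancy of ∂x needs n ≥ 4: for n = 3 the word 010 also has a triangle of weight 3.
module Submission where

open import Defs
open import Data.Bool using (Bool; true; false)
open import Data.Bool.Properties using () renaming (_≟_ to _≟ᵇ_)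
open import Data.Nat using (ℕ; zero; suc; _≤_; _<_; _+_; z≤n; s≤s)
open import Data.Nat.Properties
  using (module ≤-Reasoning; suc-injective; +-identityʳ; +-mono-≤; +-monoʳ-≤; +-cancelʳ-≤; ≤-antisym; ≤-refl; <-irrefl)
open import Data.Vec using (Vec; []; _∷_; replicate)
open import Data.Vec.Properties using (≡-dec; ∷-injectiveʳ)
open import Data.Product using (_×_; ∃; _,_)
open import Data.Sum using (_⊎_; inj₁; inj₂)
open import Data.Empty using (⊥-elim)
open import Function.Bundles using (_⇔_; mk⇔)
open import Relation.Nullary using (yes; no)
open import Relation.Binary.PropositionalEquality
  using (_≡_; _≢_; refl; cong; cong₂; sym; trans; subst)

zeros : (n : ℕ) → Vec Bool n
zeros n = replicate n false

triangleWeight-∷ : ∀ {n} (x : Vec Bool (suc n)) → triangleWeight x ≡ weight x + triangleWeight (∂ x)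
triangleWeight-∷ (_ ∷ _) = refl

weight-zeros : ∀ n → weight (zeros n) ≡ 0
weight-zeros zero    = refl
weight-zeros (suc n) = weight-zeros n

weight-a₁ : ∀ n → weight (a₁ n) ≡ n
weight-a₁ zero    = refl
weight-a₁ (suc n) = cong suc (weight-a₁ n)

weight-a₃ : ∀ n → weight (a₃ n) ≡ 1
weight-a₃ zero    = refl
weight-a₃ (suc n) = weight-a₃ n

∂-zeros : ∀ n → ∂ (zeros (suc n)) ≡ zeros n
∂-zeros zero    = refl
∂-zeros (suc n) = cong (false ∷_) (∂-zeros n)

∂-a₁ : ∀ n → ∂ (a₁ (suc n)) ≡ zeros n
∂-a₁ zero    = refl
∂-a₁ (suc n) = cong (false ∷_) (∂-a₁ n)

∂-a₂ : ∀ n → ∂ (a₂ (suc n)) ≡ a₂ n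
∂-a₂ n = cong (true ∷_) (∂-zeros n)

∂-a₃ : ∀ n → ∂ (a₃ (suc n)) ≡ a₃ n
∂-a₃ zero    = refl
∂-a₃ (suc n) = cong (false ∷_) (∂-a₃ n)

triangleWeight-zeros : ∀ n → triangleWeight (zeros n) ≡ 0
triangleWeight-zeros zero    = refl
triangleWeight-zeros (suc n) =
  cong₂ _+_ (weight-zeros n) (trans (cong triangleWeight (∂-zeros n)) (triangleWeight-zeros n))

triangleWeight-a₁ : ∀ n → triangleWeight (a₁ n) ≡ n
triangleWeight-a₁ zero    = refl
triangleWeight-a₁ (suc n) =
  trans (cong₂ _+_ (weight-a₁ (suc n)) (trans (cong triangleWeight (∂-a₁ n)) (triangleWeight-zeros n)))
        (+-identityʳ (suc n))

triangleWeight-a₂ : ∀ n → triangleWeight (a₂ n) ≡ suc n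
triangleWeight-a₂ zero    = refl
triangleWeight-a₂ (suc n) =
  cong₂ _+_ (cong suc (weight-zeros n)) (trans (cong triangleWeight (∂-a₂ n)) (triangleWeight-a₂ n))

triangleWeight-a₃ : ∀ n → triangleWeight (a₃ n) ≡ suc n
triangleWeight-a₃ zero    = refl
triangleWeight-a₃ (suc n) =
  cong₂ _+_ (weight-a₃ (suc n)) (trans (cong triangleWeight (∂-a₃ n)) (triangleWeight-a₃ n))

weight≡0⇒zeros : ∀ {n} (x : Vec Bool n) → weight x ≡ 0 → x ≡ zeros n
weight≡0⇒zeros []           _ = refl
weight≡0⇒zeros (false ∷ xs) w = cong (false ∷_) (weight≡0⇒zeros xs w)

≢zeros⇒1≤weight : ∀ {n} (x : Vec Bool n) → x ≢ zeros n → 1 ≤ weight x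
≢zeros⇒1≤weight []           x≢0 = ⊥-elim (x≢0 refl)
≢zeros⇒1≤weight (true ∷ _)   _   = s≤s z≤n
≢zeros⇒1≤weight (false ∷ xs) x≢0 = ≢zeros⇒1≤weight xs (λ xs≡0 → x≢0 (cong (false ∷_) xs≡0))

∂≡zeros⇒constant : ∀ {n} (x : Vec Bool (suc n)) → ∂ x ≡ zeros n → x ≡ a₁ (suc n) ⊎ x ≡ zeros (suc n)
∂≡zeros⇒constant (true ∷ [])  _ = inj₁ refl
∂≡zeros⇒constant (false ∷ []) _ = inj₂ refl
∂≡zeros⇒constant (true ∷ true ∷ xs) ∂x≡0 with ∂≡zeros⇒constant (true ∷ xs) (∷-injectiveʳ ∂x≡0)
... | inj₁ p = inj₁ (cong (true ∷_) p)
∂≡zeros⇒constant (false ∷ false ∷ xs) ∂x≡0 with ∂≡zeros⇒constant (false ∷ xs) (∷-injectiveʳ ∂x≡0)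
... | inj₂ p = inj₂ (cong (false ∷_) p)

≢zeros⇒length≤triangleWeight : ∀ {n} (x : Vec Bool n) → x ≢ zeros n → n ≤ triangleWeight x
≢zeros⇒length≤triangleWeight [] _ = z≤n
≢zeros⇒length≤triangleWeight {suc n} x x≢0 with ≡-dec _≟ᵇ_ (∂ x) (zeros n)
... | yes ∂x≡0 with ∂≡zeros⇒constant x ∂x≡0
...   | inj₁ x≡1 = subst (suc n ≤_) (sym (trans (cong triangleWeight x≡1) (triangleWeight-a₁ (suc n)))) ≤-refl
...   | inj₂ x≡0 = ⊥-elim (x≢0 x≡0)
≢zeros⇒length≤triangleWeight {suc n} x x≢0 | no ∂x≢0 =
  subst (suc n ≤_) (sym (triangleWeight-∷ x))
        (+-mono-≤ (≢zeros⇒1≤weight x x≢0) (≢zeros⇒length≤triangleWeight (∂ x) ∂x≢0))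

weight≡1⇒end⊎weight∂≡2 : ∀ {n} (x : Vec Bool (suc n)) → weight x ≡ 1 →
  x ≡ a₂ n ⊎ x ≡ a₃ n ⊎ weight (∂ x) ≡ 2
weight≡1⇒end⊎weight∂≡2 (true ∷ xs) w = inj₁ (cong (true ∷_) (weight≡0⇒zeros xs (suc-injective w)))
weight≡1⇒end⊎weight∂≡2 (false ∷ true ∷ xs) w with weight≡0⇒zeros xs (suc-injective w)
weight≡1⇒end⊎weight∂≡2 (false ∷ true ∷ []) w | refl = inj₂ (inj₁ refl)
weight≡1⇒end⊎weight∂≡2 {suc (suc k)} (false ∷ true ∷ _ ∷ _) w | refl =
  inj₂ (inj₂ (cong (2 +_) (trans (cong weight (∂-zeros k)) (weight-zeros k))))
weight≡1⇒end⊎weight∂≡2 (false ∷ false ∷ xs) w with weight≡1⇒end⊎weight∂≡2 (false ∷ xs) w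
... | inj₂ (inj₁ p) = inj₂ (inj₁ (cong (false ∷_) p))
... | inj₂ (inj₂ p) = inj₂ (inj₂ p)

∂≢zeros⇒weight+length≤triangleWeight : ∀ {n} (x : Vec Bool (suc n)) → ∂ x ≢ zeros n →
  weight x + n ≤ triangleWeight x
∂≢zeros⇒weight+length≤triangleWeight x ∂x≢0 =
  subst (weight x + _ ≤_) (sym (triangleWeight-∷ x))
        (+-monoʳ-≤ (weight x) (≢zeros⇒length≤triangleWeight (∂ x) ∂x≢0))

∂≢zeros⇒weight≡1 : ∀ {n} (x : Vec Bool (suc n)) → ∂ x ≢ zeros n → triangleWeight x ≡ suc n →
  weight x ≡ 1
∂≢zeros⇒weight≡1 {n} x ∂x≢0 T≡n+1 = ≤-antisym
  (+-cancelʳ-≤ n (weight x) 1 (subst (weight x + n ≤_) T≡n+1 (∂≢zeros⇒weight+length≤triangleWeight x ∂x≢0)))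
  (≢zeros⇒1≤weight x (λ x≡0 → ∂x≢0 (trans (cong ∂ x≡0) (∂-zeros n))))

weight≡2⇒∂≢zeros : ∀ {n} (x : Vec Bool (suc n)) → 2 ≤ n → weight x ≡ 2 → ∂ x ≢ zeros n
weight≡2⇒∂≢zeros {n} x 2≤n w ∂x≡0 with ∂≡zeros⇒constant x ∂x≡0
... | inj₁ refl = <-irrefl (trans (sym w) (weight-a₁ (suc n))) (s≤s 2≤n)
... | inj₂ refl with trans (sym (weight-zeros (suc n))) w
...   | ()

weight∂≡2⇒length<triangleWeight : ∀ {n} → 3 ≤ n → (x : Vec Bool (suc n)) → weight x ≡ 1 →
  weight (∂ x) ≡ 2 → suc n < triangleWeight x
weight∂≡2⇒length<triangleWeight {suc k} (s≤s 2≤k) x weight≡1 weight∂x≡2 = begin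
  suc (suc (suc k))                   ≡⟨ cong₂ (λ a b → a + (b + k)) weight≡1 weight∂x≡2 ⟨
  weight x + (weight (∂ x) + k)       ≤⟨ +-monoʳ-≤ (weight x) (∂≢zeros⇒weight+length≤triangleWeight (∂ x) ∂∂x≢0) ⟩
  weight x + triangleWeight (∂ x)     ≡⟨ triangleWeight-∷ x ⟨
  triangleWeight x                    ∎
  where
  open ≤-Reasoning
  ∂∂x≢0 : ∂ (∂ x) ≢ zeros k
  ∂∂x≢0 = weight≡2⇒∂≢zeros (∂ x) 2≤k weight∂x≡2

W₁-classification : ∀ {n} → 3 ≤ n → (x : Vec Bool (suc n)) → triangleWeight x ≡ suc n →
  x ≡ a₁ (suc n) ⊎ x ≡ a₂ n ⊎ x ≡ a₃ n
W₁-classification {n} 3≤n x T≡n+1 with ≡-dec _≟ᵇ_ (∂ x) (zeros n)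
... | yes ∂x≡0 with ∂≡zeros⇒constant x ∂x≡0
...   | inj₁ x≡1 = inj₁ x≡1
...   | inj₂ refl with trans (sym (triangleWeight-zeros (suc n))) T≡n+1
...     | ()
W₁-classification {n} 3≤n x T≡n+1 | no ∂x≢0
  with weight≡1⇒end⊎weight∂≡2 x (∂≢zeros⇒weight≡1 x ∂x≢0 T≡n+1)
... | inj₁ x≡a₂ = inj₂ (inj₁ x≡a₂)
... | inj₂ (inj₁ x≡a₃) = inj₂ (inj₂ x≡a₃)
... | inj₂ (inj₂ weight∂x≡2) = ⊥-elim (<-irrefl (sym T≡n+1)
  (weight∂≡2⇒length<triangleWeight 3≤n x (∂≢zeros⇒weight≡1 x ∂x≢0 T≡n+1) weight∂x≡2))

triangleWeight-a₁a₂a₃ : ∀ {n} (x : Vec Bool (suc n)) → x ≡ a₁ (suc n) ⊎ x ≡ a₂ n ⊎ x ≡ a₃ n →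
  triangleWeight x ≡ suc n
triangleWeight-a₁a₂a₃ {n} _ (inj₁ refl)        = triangleWeight-a₁ (suc n)
triangleWeight-a₁a₂a₃ {n} _ (inj₂ (inj₁ refl)) = triangleWeight-a₂ n
triangleWeight-a₁a₂a₃ {n} _ (inj₂ (inj₂ refl)) = triangleWeight-a₃ n

theorem4p4 : (m : ℕ) → 3 ≤ m →
    ((∃ λ (x : Vec Bool (suc m)) → triangleWeight x ≡ suc m)
     × (∀ (x : Vec Bool (suc m)) → triangleWeight x ≢ 0 → suc m ≤ triangleWeight x))
    × (∀ (x : Vec Bool (suc m)) →
         (triangleWeight x ≡ suc m) ⇔
           (x ≡ a₁ (suc m) ⊎ x ≡ a₂ m ⊎ x ≡ a₃ m))
theorem4p4 m 3≤m =
  ((a₁ (suc m) , triangleWeight-a₁ (suc m)) , w₁-lower-bound) ,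
  λ x → mk⇔ (W₁-classification 3≤m x) (triangleWeight-a₁a₂a₃ x)
  where
  w₁-lower-bound : ∀ (x : Vec Bool (suc m)) → triangleWeight x ≢ 0 → suc m ≤ triangleWeight x
  w₁-lower-bound x T≢0 = ≢zeros⇒length≤triangleWeight x
    (λ x≡0 → T≢0 (trans (cong triangleWeight x≡0) (triangleWeight-zeros (suc m))))
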